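{- Consider the flow-level coflow scheduling problem on $m$ identical parallel network cores, defined in the context below. Let FLPT be the following algorithm. Initialize $load_I(i,h)=0$ and $load_O(j,h)=0$ for all input ports $i$, output ports $j$ and cores $h\in\{1,\dots,m\}$, and $\mathcal{A}_h=\emptyset$ for all $h$. For each flow $(i,j,k)\in\mathcal{F}$, taken in non-increasing order of $d_{i,j,k}$ (ties broken arbitrarily), let $h^*=\arg\min_{h}\{load_I(i,h)+load_O(j,h)\}$; add $(i,j,k)$ to $\mathcal{A}_{h^*}$ and increase both $load_I(i,h^*)$ and $load_O(j,h^*)$ by $d_{i,j,k}$. Output the assignment $\{\mathcal{A}_h\}_{h=1}^m$ (every flow of $\mathcal{A}_h$ is transmitted entirely on core $h$). Then FLPT is a $\left(\frac{8}{3}-\frac{2}{3m}\right)$-approximation algorithm: if $T$ is the makespan of the schedule found by FLPT and $T^*$ is the optimal makespan, then $T\le \left(\frac{8}{3}-\frac{2}{3m}\right)T^*$.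
   Context: Identical parallel networks: there are $m$ network cores, each a non-blocking $N\times N$ switch with input ports $\mathcal{I}=\{1,\dots,N\}$ and output ports $\mathcal{J}=\{1,\dots,N\}$; the $i$-th source server is connected to input port $i$ of every core and the $j$-th destination server to output port $j$ of every core. Every port of every core can transfer at most one unit of data per unit of time. A set $\mathcal{K}=\{1,\dots,K\}$ of coflows is given, all released at time $0$; coflow $k$ is an $N\times N$ matrix $D^{(k)}$ of nonnegative integers, and each nonzero entry $d_{i,j,k}$ is a flow $(i,j,k)$ that must transfer $d_{i,j,k}$ units of data from input port $i$ to output port $j$. $\mathcal{F}$ is the set of all flows. In the flow-level scheduling problem, each flow must be transmitted entirely through a single core (flows may not be split across cores), but different flows of the same coflow may use different cores. The completion time $C_k$ of coflow $k$ is the time at which its last flow finishes, and the makespan is $\max_k C_k$; $T^*$ denotes the minimum makespan over all feasible flow-level schedules. -}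

module Defs where

open import Data.Nat using (ℕ; zero; suc; _+_; _*_; _∸_; _≤_; _<_)
open import Data.Fin using (Fin)
open import Data.Bool using (Bool; true; false; if_then_else_)
open import Data.Product using (_×_; _,_; proj₁; proj₂; ∃-syntax)
open import Data.List using (List; []; _∷_)
open import Data.List.Membership.Propositional using (_∈_)
open import Data.List.Relation.Unary.Unique.Propositional using (Unique)
open import Data.List.Relation.Unary.Linked using (Linked)
open import Relation.Binary.PropositionalEquality using (_≡_; _≢_)
open import Relation.Nullary using (yes; no)
open import Data.Fin using (_≟_)

-- An instance: N ports, K coflows; D k i j = d_{i,j,k} (0 means "no flow").
Demand : ℕ → ℕ → Set
Demand N K = Fin K → Fin N → Fin N → ℕ

Flow : ℕ → ℕ → Set
Flow N K = Fin N × Fin N × Fin K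

src : ∀ {N K} → Flow N K → Fin N
src (i , j , k) = i

dst : ∀ {N K} → Flow N K → Fin N
dst (i , j , k) = j

size : ∀ {N K} → Demand N K → Flow N K → ℕ
size D (i , j , k) = D k i j

-- Schedules (discrete unit time slots [t, t+1)).

countActive : (ℕ → Bool) → ℕ → ℕ
countActive a zero = zero
countActive a (suc T) = countActive a T + (if a T then 1 else 0)

record Schedule (m N K : ℕ) : Set where
  field
    core   : Flow N K → Fin m
    active : Flow N K → ℕ → Bool
open Schedule public

-- all transmissions happen before time T (i.e. every flow, hence every
-- coflow, is complete by time T: makespan ≤ T)
CompletesBy : ∀ {m N K} → Schedule m N K → ℕ → Set
CompletesBy S T = ∀ f t → active S f t ≡ true → t < T

Feasible : ∀ {m N K} → Demand N K → Schedule m N K → ℕ → Set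
Feasible {m} {N} {K} D S T =
  CompletesBy S T ×
  (∀ (f : Flow N K) → countActive (active S f) T ≡ size D f) ×
  (∀ (f g : Flow N K) (t : ℕ) → f ≢ g → core S f ≡ core S g →
     active S f t ≡ true → active S g t ≡ true →
     (src f ≢ src g) × (dst f ≢ dst g))

loadI : ∀ {m N K} → Demand N K → List (Flow N K × Fin m) → Fin N → Fin m → ℕ
loadI D [] i h = 0
loadI D ((f , h') ∷ as) i h with src f ≟ i | h' ≟ h
... | yes _ | yes _ = size D f + loadI D as i h
... | _     | _     = loadI D as i h

loadO : ∀ {m N K} → Demand N K → List (Flow N K × Fin m) → Fin N → Fin m → ℕ
loadO D [] j h = 0
loadO D ((f , h') ∷ as) j h with dst f ≟ j | h' ≟ h
... | yes _ | yes _ = size D f + loadO D as j h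
... | _     | _     = loadO D as j h

-- FLPT D acc fs out : processing flows fs in order, starting from the
-- assignment acc, FLPT (with some tie-breaking in the argmin) can end with
-- the assignment out.
data FLPT {m N K : ℕ} (D : Demand N K) :
     List (Flow N K × Fin m) → List (Flow N K) → List (Flow N K × Fin m) → Set where
  done : ∀ {acc} → FLPT D acc [] acc
  step : ∀ {acc f fs out} (h : Fin m) →
         (∀ (h' : Fin m) → loadI D acc (src f) h + loadO D acc (dst f) h
                         ≤ loadI D acc (src f) h' + loadO D acc (dst f) h') →
         FLPT D ((f , h) ∷ acc) fs out →
         FLPT D acc (f ∷ fs) out

FlowOrder : ∀ {N K} → Demand N K → List (Flow N K) → Set
FlowOrder {N} {K} D fs =
  Unique fs ×
  (∀ (f : Flow N K) → (f ∈ fs → 0 < size D f) × (0 < size D f → f ∈ fs)) ×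
  Linked (λ f g → size D g ≤ size D f) fs

RespectsAssignment : ∀ {m N K} → Schedule m N K → List (Flow N K × Fin m) → Set
RespectsAssignment S out = ∀ f h → (f , h) ∈ out → core S f ≡ h

module Submission where

-- FLPT's assignment can be scheduled within its largest per-core port
-- load: on one core the flows form a bipartite multigraph, and König's
-- edge-colouring theorem (here by Kempe-chain swaps of two time slots,
-- adding one unit of data at a time) schedules it within its maximum
-- degree.  It remains to bound that load.  When FLPT places a flow f of
-- size d, the chosen core minimises the combined load μ of f's two ports.
-- If 3d ≤ 2T*, averaging over the m cores and the fact that a port carries
-- at most mT* in any feasible schedule give mμ + 2d ≤ 2mT*.  If 3d > 2T*,
-- all earlier flows exceed T*/2; two such flows sharing a port need
-- different cores in the optimum, so each port of f carries at most m − 1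
-- of them, some core carries at most one, and μ ≤ T*.  Both cases give
-- 3m(d + μ) ≤ (8m − 2)T*.

open import Defs
open import Data.Bool using (Bool; true; false; if_then_else_; not; _∧_)
import Data.Bool as Bool
open import Data.Bool.Properties using (¬-not; not-involutive)
open import Data.Empty using (⊥; ⊥-elim)
open import Data.Maybe using (Maybe; just; nothing)
open import Data.Maybe.Properties using (just-injective)
open import Data.Fin using (Fin; _≟_; toℕ; combine)
import Data.Fin as Fin
open import Data.Fin.Properties using (pigeonhole; toℕ<n; any?; combine-injective)
import Data.Fin.Properties as Finₚ
open import Data.List using (List; []; _∷_; _++_; map; filter; length; allFin; replicate; _ʳ++_; cartesianProductWith)
open import Data.List.Extrema.Nat using (max; argmax-all; xs≤max)
open import Data.List.Membership.Propositional using (_∈_; _∉_)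
open import Data.List.Membership.Propositional.Properties
  using (∈-allFin; ∈-filter⁺; ∈-filter⁻; ∈-map⁺; ∈-map⁻; ∈-cartesianProductWith⁺; ∈-cartesianProductWith⁻)
open import Data.List.Relation.Unary.All as All using (All; []; _∷_)
open import Data.List.Relation.Unary.All.Properties using (All¬⇒¬Any)
open import Data.List.Relation.Unary.AllPairs as AllPairs using (AllPairs; []; _∷_)
open import Data.List.Relation.Unary.Any using (here; there)
open import Data.List.Relation.Unary.Any.Properties using (reverseAcc⁻)
open import Data.List.Relation.Unary.Linked.Properties using (Linked⇒AllPairs)
open import Data.List.Relation.Unary.Unique.Propositional using (Unique)
open import Data.List.Relation.Unary.Unique.Propositional.Properties using (allFin⁺; filter⁺)
open import Data.List.Properties using (length-tabulate; filter-accept)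
open import Data.Nat using (ℕ; zero; suc; _+_; _*_; _∸_; _⊔_; _≤_; _<_; z≤n; s≤s; _≤?_) renaming (_≟_ to _≟ℕ_)
open import Data.Nat.GeneralisedArithmetic using (fold; fold-+)
open import Data.Nat.Tactic.RingSolver using (solve-∀)
open import Data.Nat.Properties hiding (_≟_)
open import Algebra.Properties.CommutativeSemigroup +-commutativeSemigroup using (interchange; xy∙z≈xz∙y)
open import Data.Product using (_×_; _,_; proj₁; proj₂; ∃; ∃-syntax; Σ-syntax)
open import Data.Product.Properties using (≡-dec)
open import Data.Sum using (_⊎_; inj₁; inj₂)
open import Function using (_∘_; flip; id)
open import Relation.Binary.Definitions using (DecidableEquality)
open import Relation.Binary.PropositionalEquality
open import Relation.Nullary using (Dec; yes; no; does; ¬_; contradiction)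
open import Relation.Nullary.Decidable using (dec-true; dec-false; _×-dec_; map′; decidable-stable)
open import Relation.Unary using (Decidable)

private
  variable
    A : Set
    P : Set
    m N K : ℕ

if-dec-yes : ∀ {B : Set} {x y : B} (d : Dec P) → P → (if does d then x else y) ≡ x
if-dec-yes {x = x} {y} d p = cong (if_then x else y) (dec-true d p)

if-dec-no : ∀ {B : Set} {x y : B} (d : Dec P) → ¬ P → (if does d then x else y) ≡ y
if-dec-no {x = x} {y} d ¬p = cong (if_then x else y) (dec-false d ¬p)

bit : Bool → ℕ
bit b = if b then 1 else 0

bit≤1 : ∀ b → bit b ≤ 1
bit≤1 true  = ≤-refl
bit≤1 false = z≤n

bit≡0⇒false : ∀ {b} → bit b ≡ 0 → b ≡ false
bit≡0⇒false {false} _ = refl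

sumBy : (A → ℕ) → List A → ℕ
sumBy w []       = 0
sumBy w (x ∷ xs) = w x + sumBy w xs

sumBy-cong : ∀ {u v : A → ℕ} xs → (∀ {x} → x ∈ xs → u x ≡ v x) → sumBy u xs ≡ sumBy v xs
sumBy-cong []       eq = refl
sumBy-cong (x ∷ xs) eq = cong₂ _+_ (eq (here refl)) (sumBy-cong xs (eq ∘ there))

sumBy-+ : ∀ (u v : A → ℕ) xs → sumBy (λ x → u x + v x) xs ≡ sumBy u xs + sumBy v xs
sumBy-+ u v []       = refl
sumBy-+ u v (x ∷ xs) = trans (cong (u x + v x +_) (sumBy-+ u v xs)) (interchange (u x) (v x) _ _)

sumBy-mono-≤ : ∀ {u v : A → ℕ} xs → (∀ {x} → x ∈ xs → u x ≤ v x) → sumBy u xs ≤ sumBy v xs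
sumBy-mono-≤ []       le = z≤n
sumBy-mono-≤ (x ∷ xs) le = +-mono-≤ (le (here refl)) (sumBy-mono-≤ xs (le ∘ there))

sumBy-mono-< : ∀ {u v : A → ℕ} {y} xs → (∀ {x} → x ∈ xs → u x ≤ v x) → y ∈ xs → u y < v y →
               sumBy u xs < sumBy v xs
sumBy-mono-< (x ∷ xs) le (here refl) lt = +-mono-<-≤ lt (sumBy-mono-≤ xs (le ∘ there))
sumBy-mono-< (x ∷ xs) le (there y∈) lt = +-mono-≤-< (le (here refl)) (sumBy-mono-< xs (le ∘ there) y∈ lt)

sumBy≡0⇒≡0 : ∀ {w : A → ℕ} {y} xs → sumBy w xs ≡ 0 → y ∈ xs → w y ≡ 0
sumBy≡0⇒≡0 {w = w} (x ∷ xs) eq (here refl) = m+n≡0⇒m≡0 (w x) eq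
sumBy≡0⇒≡0 {w = w} (x ∷ xs) eq (there y∈) = sumBy≡0⇒≡0 xs (m+n≡0⇒n≡0 (w x) eq) y∈

sumBy-zero : ∀ (xs : List A) → sumBy (λ _ → 0) xs ≡ 0
sumBy-zero []       = refl
sumBy-zero (x ∷ xs) = sumBy-zero xs

sumBy-one : ∀ (xs : List A) → sumBy (λ _ → 1) xs ≡ length xs
sumBy-one []       = refl
sumBy-one (x ∷ xs) = cong suc (sumBy-one xs)

sumBy≤length* : ∀ {w : A → ℕ} {c} xs → (∀ {x} → x ∈ xs → w x ≤ c) → sumBy w xs ≤ length xs * c
sumBy≤length* []       le = z≤n
sumBy≤length* (x ∷ xs) le = +-mono-≤ (le (here refl)) (sumBy≤length* xs (le ∘ there))

length*≤sumBy : ∀ {w : A → ℕ} {c} xs → (∀ {x} → x ∈ xs → c ≤ w x) → length xs * c ≤ sumBy w xs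
length*≤sumBy []       le = z≤n
length*≤sumBy (x ∷ xs) le = +-mono-≤ (le (here refl)) (length*≤sumBy xs (le ∘ there))

m*≤sumBy-allFin : ∀ {m} {v : Fin m → ℕ} {c} → (∀ h → c ≤ v h) → m * c ≤ sumBy v (allFin m)
m*≤sumBy-allFin {m} {v} {c} c≤ =
  subst (_≤ sumBy v (allFin m)) (cong (_* c) (length-tabulate {n = m} id)) (length*≤sumBy (allFin m) λ {h} _ → c≤ h)

sumBy-comm : ∀ {B : Set} (w : A → B → ℕ) xs ys →
             sumBy (λ x → sumBy (w x) ys) xs ≡ sumBy (λ y → sumBy (λ x → w x y) xs) ys
sumBy-comm w []       ys = sym (sumBy-zero ys)
sumBy-comm w (x ∷ xs) ys = trans (cong (sumBy (w x) ys +_) (sumBy-comm w xs ys))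
                                 (sym (sumBy-+ (w x) _ ys))

sumBy-filter-∷ : ∀ {P : A → Set} (P? : Decidable P) (w : A → ℕ) x xs →
                 sumBy w (filter P? (x ∷ xs)) ≡ (if does (P? x) then w x else 0) + sumBy w (filter P? xs)
sumBy-filter-∷ P? w x xs with does (P? x)
... | true  = refl
... | false = refl

module _ (_≟ᴬ_ : DecidableEquality A) where

  sumBy-indicator : ∀ {y} c xs → Unique xs → y ∈ xs → sumBy (λ x → if does (y ≟ᴬ x) then c else 0) xs ≡ c
  sumBy-indicator c (x ∷ xs) (x∉xs ∷ u) (here refl) with x ≟ᴬ x
  ... | yes _  = trans (cong (c +_) (trans (sumBy-cong xs absent) (sumBy-zero xs))) (+-identityʳ c)
    where
    absent : ∀ {z} → z ∈ xs → (if does (x ≟ᴬ z) then c else 0) ≡ 0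
    absent {z} z∈ with x ≟ᴬ z
    ... | yes refl = contradiction refl (All.lookup x∉xs z∈)
    ... | no _     = refl
  ... | no x≢x = contradiction refl x≢x
  sumBy-indicator {y} c (x ∷ xs) (x∉xs ∷ u) (there y∈) with y ≟ᴬ x
  ... | yes refl = contradiction refl (All.lookup x∉xs y∈)
  ... | no _     = sumBy-indicator c xs u y∈

sumBy-bit≤1 : ∀ (q : A → Bool) xs → Unique xs →
              (∀ {x y} → x ∈ xs → y ∈ xs → q x ≡ true → q y ≡ true → x ≡ y) →
              sumBy (bit ∘ q) xs ≤ 1
sumBy-bit≤1 q []       _            _    = z≤n
sumBy-bit≤1 q (x ∷ xs) (x∉xs ∷ u) same with q x in qx
... | false = sumBy-bit≤1 q xs u λ x∈ y∈ → same (there x∈) (there y∈)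
... | true  = ≤-reflexive (cong suc (trans (sumBy-cong xs unselected) (sumBy-zero xs)))
  where
  unselected : ∀ {y} → y ∈ xs → bit (q y) ≡ 0
  unselected {y} y∈ with q y in qy
  ... | true  = contradiction (same (here refl) (there y∈) qx qy) (All.lookup x∉xs y∈)
  ... | false = refl

-- Fubini: count every selected element under its label; no label is
-- used twice.
sumBy-bit≤m : ∀ {m} (label : A → Fin m) (q : A → Bool) xs → Unique xs →
              (∀ {x y} → x ∈ xs → y ∈ xs → q x ≡ true → q y ≡ true → label x ≡ label y → x ≡ y) →
              sumBy (bit ∘ q) xs ≤ m
sumBy-bit≤m {A = A} {m = m} label q xs u inj = begin
  sumBy (bit ∘ q) xs                                        ≡⟨ sumBy-cong xs (λ {x} _ → split x) ⟩
  sumBy (λ x → sumBy (labelled x) (allFin m)) xs          ≡⟨ sumBy-comm labelled xs (allFin m) ⟩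
  sumBy (λ h → sumBy (λ x → labelled x h) xs) (allFin m)  ≤⟨ sumBy≤length* (allFin m) (λ _ → perLabel _) ⟩
  length (allFin m) * 1                                     ≡⟨ cong (_* 1) (length-tabulate {n = m} id) ⟩
  m * 1                                                     ≡⟨ *-identityʳ m ⟩
  m                                                         ∎
  where
  open ≤-Reasoning
  labelled : A → Fin m → ℕ
  labelled x h = bit (q x ∧ does (label x ≟ h))
  split : ∀ x → bit (q x) ≡ sumBy (λ h → bit (q x ∧ does (label x ≟ h))) (allFin m)
  split x with q x
  ... | true  = sym (sumBy-indicator _≟_ 1 (allFin m) (allFin⁺ m) (∈-allFin (label x)))
  ... | false = sym (sumBy-zero (allFin m))
  selected : ∀ {x h} → (q x ∧ does (label x ≟ h)) ≡ true → q x ≡ true × label x ≡ h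
  selected {x} {h} sel with q x | label x ≟ h
  ... | true | yes on = refl , on
  perLabel : ∀ h → sumBy (λ x → labelled x h) xs ≤ 1
  perLabel h = sumBy-bit≤1 (λ x → q x ∧ does (label x ≟ h)) xs u λ x∈ y∈ sx sy →
    let (qx , cx) = selected sx ; (qy , cy) = selected sy in inj x∈ y∈ qx qy (trans cx (sym cy))

AllPairs-ʳ++⁻ : ∀ {R : A → A → Set} xs {ys} → AllPairs R (xs ʳ++ ys) →
                AllPairs (flip R) xs × All (λ x → All (R x) ys) xs × AllPairs R ys
AllPairs-ʳ++⁻ []       pairs = [] , [] , pairs
AllPairs-ʳ++⁻ (x ∷ xs) pairs with AllPairs-ʳ++⁻ xs pairs
... | reversed , across , (x~ys ∷ ys-pairs) = All.map All.head across ∷ reversed , x~ys ∷ All.map All.tail across , ys-pairs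

countActive-cong : ∀ {u v : ℕ → Bool} T → (∀ {t} → t < T → u t ≡ v t) → countActive u T ≡ countActive v T
countActive-cong zero    eq = refl
countActive-cong (suc T) eq = cong₂ _+_ (countActive-cong T (eq ∘ m<n⇒m<1+n)) (cong bit (eq (n<1+n T)))

countActive≤ : ∀ u T → countActive u T ≤ T
countActive≤ u zero    = z≤n
countActive≤ u (suc T) = ≤-trans (+-mono-≤ (countActive≤ u T) (bit≤1 (u T))) (≤-reflexive (+-comm T 1))

active⇒countActive>0 : ∀ {u t} T → u t ≡ true → t < T → 0 < countActive u T
active⇒countActive>0 {u} {t} (suc T) ut t<1+T with m≤n⇒m<n∨m≡n (≤-pred t<1+T)
... | inj₁ t<T  = ≤-trans (active⇒countActive>0 T ut t<T) (m≤m+n _ _)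
... | inj₂ refl = ≤-trans (≤-reflexive (sym (cong bit ut))) (m≤n+m _ _)

disjoint⇒countActive-+≤ : ∀ {u v} T → (∀ t → u t ≡ true → v t ≡ true → ⊥) →
                          countActive u T + countActive v T ≤ T
disjoint⇒countActive-+≤         zero    _        = z≤n
disjoint⇒countActive-+≤ {u} {v} (suc T) disjoint = begin
  (countActive u T + bit (u T)) + (countActive v T + bit (v T))
    ≡⟨ interchange (countActive u T) _ _ _ ⟩
  (countActive u T + countActive v T) + (bit (u T) + bit (v T))
    ≤⟨ +-mono-≤ (disjoint⇒countActive-+≤ T disjoint) (atMostOne (u T) (v T) (disjoint T)) ⟩
  T + 1
    ≡⟨ +-comm T 1 ⟩
  suc T ∎
  where
  open ≤-Reasoning
  atMostOne : ∀ b c → (b ≡ true → c ≡ true → ⊥) → bit b + bit c ≤ 1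
  atMostOne true  true  both = ⊥-elim (both refl refl)
  atMostOne true  false _    = ≤-refl
  atMostOne false c     _    = bit≤1 c

update : (ℕ → Bool) → ℕ → Bool → ℕ → Bool
update u a b t = if does (t ≟ℕ a) then b else u t

update-≡ : ∀ u a b → update u a b a ≡ b
update-≡ u a b = if-dec-yes (a ≟ℕ a) refl

update-≢ : ∀ u {a} b {t} → t ≢ a → update u a b t ≡ u t
update-≢ u {a} b {t} t≢a = if-dec-no (t ≟ℕ a) t≢a

countActive-update : ∀ u {a} b T → a < T → countActive (update u a b) T + bit (u a) ≡ countActive u T + bit b
countActive-update u {a} b (suc T) a<1+T with T ≟ℕ a
... | yes refl = begin
  countActive (update u T b) T + bit (update u T b T) + bit (u T)
    ≡⟨ cong₂ (λ n c → n + bit c + bit (u T)) unchanged (update-≡ u T b) ⟩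
  countActive u T + bit b + bit (u T)               ≡⟨ xy∙z≈xz∙y (countActive u T) _ _ ⟩
  countActive u T + bit (u T) + bit b               ∎
  where
  open ≡-Reasoning
  unchanged : countActive (update u T b) T ≡ countActive u T
  unchanged = countActive-cong T λ t<T → update-≢ u b (<⇒≢ t<T)
... | no T≢a = begin
  countActive (update u a b) T + bit (update u a b T) + bit (u a)
    ≡⟨ cong (λ c → countActive (update u a b) T + bit c + bit (u a)) (update-≢ u b T≢a) ⟩
  countActive (update u a b) T + bit (u T) + bit (u a) ≡⟨ xy∙z≈xz∙y (countActive (update u a b) T) _ _ ⟩
  countActive (update u a b) T + bit (u a) + bit (u T) ≡⟨ cong (_+ bit (u T)) (countActive-update u b T a<T) ⟩
  countActive u T + bit b + bit (u T)                  ≡⟨ xy∙z≈xz∙y (countActive u T) _ _ ⟩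
  countActive u T + bit (u T) + bit b                  ∎
  where
  open ≡-Reasoning
  a<T : a < T
  a<T = ≤∧≢⇒< (≤-pred a<1+T) (T≢a ∘ sym)

swapSlots : ℕ → ℕ → (ℕ → Bool) → ℕ → Bool
swapSlots a b u = update (update u a (u b)) b (u a)

swapSlots-at₁ : ∀ a b u → swapSlots a b u a ≡ u b
swapSlots-at₁ a b u with a ≟ℕ b
... | yes refl = update-≡ (update u a (u a)) a (u a)
... | no a≢b   = trans (update-≢ (update u a (u b)) (u a) a≢b) (update-≡ u a (u b))

swapSlots-at₂ : ∀ a b u → swapSlots a b u b ≡ u a
swapSlots-at₂ a b u = update-≡ (update u a (u b)) b (u a)

swapSlots-elsewhere : ∀ a b u {t} → t ≢ a → t ≢ b → swapSlots a b u t ≡ u t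
swapSlots-elsewhere a b u t≢a t≢b = trans (update-≢ (update u a (u b)) (u a) t≢b) (update-≢ u (u b) t≢a)

countActive-swapSlots : ∀ {a b} u T → a < T → b < T → countActive (swapSlots a b u) T ≡ countActive u T
countActive-swapSlots {a} {b} u T a<T b<T = +-cancelʳ-≡ _ _ _ (begin
  countActive (swapSlots a b u) T + bit (u b)
    ≡⟨ cong (λ c → countActive (swapSlots a b u) T + bit c) (sym firstKeeps₂) ⟩
  countActive (swapSlots a b u) T + bit (first b)     ≡⟨ countActive-update first (u a) T b<T ⟩
  countActive first T + bit (u a)                     ≡⟨ countActive-update u (u b) T a<T ⟩
  countActive u T + bit (u b)                         ∎)
  where
  open ≡-Reasoning
  first : ℕ → Bool
  first = update u a (u b)
  firstKeeps₂ : first b ≡ u b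
  firstKeeps₂ with b ≟ℕ a
  ... | yes refl = update-≡ u b (u b)
  ... | no b≢a   = update-≢ u (u b) b≢a

idle-slot : ∀ (u : A → ℕ → Bool) xs T → sumBy (λ x → countActive (u x) T) xs < T →
            ∃[ t ] (t < T × ∀ {x} → x ∈ xs → u x t ≡ false)
idle-slot u xs (suc T) busy<1+T with sumBy (λ x → bit (u x T)) xs ≟ℕ 0
... | yes none = T , n<1+n T , λ x∈ → bit≡0⇒false (sumBy≡0⇒≡0 xs none x∈)
... | no some  = let (t , t<T , idle) = idle-slot u xs T busy<T in t , m<n⇒m<1+n t<T , idle
  where
  busy<T : sumBy (λ x → countActive (u x) T) xs < T
  busy<T = ≤-pred (begin-strict
    suc (sumBy (λ x → countActive (u x) T) xs)
      ≤⟨ ≤-trans (≤-reflexive (+-comm 1 _)) (+-monoʳ-≤ _ (n≢0⇒n>0 some)) ⟩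
    sumBy (λ x → countActive (u x) T) xs + sumBy (λ x → bit (u x T)) xs
      ≡⟨ sym (sumBy-+ (λ x → countActive (u x) T) (λ x → bit (u x T)) xs) ⟩
    sumBy (λ x → countActive (u x) (suc T)) xs
      <⟨ busy<1+T ⟩
    suc T ∎)
    where open ≤-Reasoning

fold-recurs : ∀ {M} (code : A → Fin M) → (∀ {x y} → code x ≡ code y → x ≡ y) → ∀ z s →
              ∃[ k ] (k < M × fold z s M ≡ fold z s k)
fold-recurs {M = M} code code-inj z s with pigeonhole (n<1+n M) (λ k → code (fold z s (toℕ k)))
... | p , q , p<q , same = M ∸ toℕ q + toℕ p , earlier , (begin
  fold z s M                         ≡⟨ cong (fold z s) (sym (m∸n+n≡m q≤M)) ⟩
  fold z s (M ∸ toℕ q + toℕ q)       ≡⟨ fold-+ z s (M ∸ toℕ q) ⟩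
  fold (fold z s (toℕ q)) s (M ∸ toℕ q) ≡⟨ cong (λ x → fold x s (M ∸ toℕ q)) (sym (code-inj same)) ⟩
  fold (fold z s (toℕ p)) s (M ∸ toℕ q) ≡⟨ sym (fold-+ z s (M ∸ toℕ q)) ⟩
  fold z s (M ∸ toℕ q + toℕ p)       ∎)
  where
  open ≡-Reasoning
  q≤M : toℕ q ≤ M
  q≤M = ≤-pred (toℕ<n q)
  earlier : M ∸ toℕ q + toℕ p < M
  earlier = ≤-trans (+-monoʳ-< (M ∸ toℕ q) p<q) (≤-reflexive (m∸n+n≡m q≤M))

_≟ᶠ_ : DecidableEquality (Flow N K)
_≟ᶠ_ = ≡-dec _≟_ (≡-dec _≟_ _≟_)

data Side : Set where
  input output : Side

port : Side → Flow N K → Fin N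
port input  = src
port output = dst

PortDisjoint : Flow N K → Flow N K → Set
PortDisjoint f g = (src f ≢ src g) × (dst f ≢ dst g)

PortDisjoint-sym : ∀ (f g : Flow N K) → PortDisjoint f g → PortDisjoint g f
PortDisjoint-sym _ _ (src≢ , dst≢) = src≢ ∘ sym , dst≢ ∘ sym

portDisjoint : ∀ {f g : Flow N K} → (∀ s → port s f ≢ port s g) → PortDisjoint f g
portDisjoint differ = differ input , differ output

PortDisjoint⇒port≢ : ∀ {f g : Flow N K} s → PortDisjoint f g → port s f ≢ port s g
PortDisjoint⇒port≢ input  = proj₁
PortDisjoint⇒port≢ output = proj₂

load : Demand N K → Side → List (Flow N K × Fin m) → Fin N → Fin m → ℕ
load D input  = loadI D
load D output = loadO D

atPort : Side → Fin N → List (Flow N K) → List (Flow N K)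
atPort s i = filter (λ f → port s f ≟ i)

∈atPort⇒port : ∀ s {i} {f : Flow N K} fs → f ∈ atPort s i fs → port s f ≡ i
∈atPort⇒port s {i} fs f∈ = proj₂ (∈-filter⁻ (λ g → port s g ≟ i) {xs = fs} f∈)

∈atPort⇒∈ : ∀ s {i} {f : Flow N K} fs → f ∈ atPort s i fs → f ∈ fs
∈atPort⇒∈ s {i} fs f∈ = proj₁ (∈-filter⁻ (λ g → port s g ≟ i) {xs = fs} f∈)

assignedAt : Side → Fin N → Fin m → List (Flow N K × Fin m) → List (Flow N K × Fin m)
assignedAt s i h = filter (λ e → port s (proj₁ e) ≟ i ×-dec proj₂ e ≟ h)

load≡sumBy : ∀ (D : Demand N K) s (as : List (Flow N K × Fin m)) i h →
             load D s as i h ≡ sumBy (size D ∘ proj₁) (assignedAt s i h as)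
load≡sumBy D input [] i h = refl
load≡sumBy D input ((f , h') ∷ as) i h with src f ≟ i | h' ≟ h
... | yes _ | yes _ = cong (size D f +_) (load≡sumBy D input as i h)
... | yes _ | no _  = load≡sumBy D input as i h
... | no _  | _     = load≡sumBy D input as i h
load≡sumBy D output [] i h = refl
load≡sumBy D output ((f , h') ∷ as) i h with dst f ≟ i | h' ≟ h
... | yes _ | yes _ = cong (size D f +_) (load≡sumBy D output as i h)
... | yes _ | no _  = load≡sumBy D output as i h
... | no _  | _     = load≡sumBy D output as i h

sumBy-assignedAt-cores : ∀ (w : Flow N K → ℕ) s i (as : List (Flow N K × Fin m)) →
  sumBy (λ h → sumBy (w ∘ proj₁) (assignedAt s i h as)) (allFin m) ≡ sumBy w (atPort s i (map proj₁ as))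
sumBy-assignedAt-cores {m = m} w s i [] = sumBy-zero (allFin m)
sumBy-assignedAt-cores {m = m} w s i ((f , h₀) ∷ as) = begin
  sumBy (λ h → sumBy (w ∘ proj₁) (assignedAt s i h ((f , h₀) ∷ as))) (allFin m)
    ≡⟨ sumBy-cong (allFin m) (λ {h} _ →
         sumBy-filter-∷ (λ e → port s (proj₁ e) ≟ i ×-dec proj₂ e ≟ h) (w ∘ proj₁) (f , h₀) as) ⟩
  sumBy (λ h → first h + rest h) (allFin m)
    ≡⟨ sumBy-+ first rest (allFin m) ⟩
  sumBy first (allFin m) + sumBy rest (allFin m)
    ≡⟨ cong₂ _+_ (onOneCore (port s f ≟ i)) (sumBy-assignedAt-cores w s i as) ⟩
  (if does (port s f ≟ i) then w f else 0) + sumBy w (atPort s i (map proj₁ as))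
    ≡⟨ sym (sumBy-filter-∷ (λ g → port s g ≟ i) w f (map proj₁ as)) ⟩
  sumBy w (atPort s i (f ∷ map proj₁ as)) ∎
  where
  open ≡-Reasoning
  first rest : Fin m → ℕ
  first h = if does (port s f ≟ i) ∧ does (h₀ ≟ h) then w f else 0
  rest h  = sumBy (w ∘ proj₁) (assignedAt s i h as)
  onOneCore : ∀ (d : Dec (port s f ≡ i)) →
              sumBy (λ h → if does d ∧ does (h₀ ≟ h) then w f else 0) (allFin m) ≡ (if does d then w f else 0)
  onOneCore (yes _) = sumBy-indicator _≟_ (w f) (allFin m) (allFin⁺ _) (∈-allFin h₀)
  onOneCore (no _)  = sumBy-zero (allFin m)

sumBy-load-cores : ∀ (D : Demand N K) s i (as : List (Flow N K × Fin m)) →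
                   sumBy (load D s as i) (allFin m) ≡ sumBy (size D) (atPort s i (map proj₁ as))
sumBy-load-cores {m = m} D s i as =
  trans (sumBy-cong (allFin m) λ {h} _ → load≡sumBy D s as i h) (sumBy-assignedAt-cores (size D) s i as)

sumBy-length-cores : ∀ s i (as : List (Flow N K × Fin m)) →
                     sumBy (λ h → length (assignedAt s i h as)) (allFin m) ≡ length (atPort s i (map proj₁ as))
sumBy-length-cores {m = m} s i as = begin
  sumBy (λ h → length (assignedAt s i h as)) (allFin m)
    ≡⟨ sumBy-cong (allFin m) (λ {h} _ → sym (sumBy-one (assignedAt s i h as))) ⟩
  sumBy (λ h → sumBy (λ _ → 1) (assignedAt s i h as)) (allFin m) ≡⟨ sumBy-assignedAt-cores (λ _ → 1) s i as ⟩
  sumBy (λ _ → 1) (atPort s i (map proj₁ as))                ≡⟨ sumBy-one (atPort s i (map proj₁ as)) ⟩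
  length (atPort s i (map proj₁ as))                          ∎
  where open ≡-Reasoning

atPort-own : ∀ s (f : Flow N K) fs → atPort s (port s f) (f ∷ fs) ≡ f ∷ atPort s (port s f) fs
atPort-own s f fs = filter-accept (λ g → port s g ≟ port s f) refl

-- Kempe chains

anyFlow? : ∀ {Q : Flow N K → Set} → Decidable Q → Dec (∃ Q)
anyFlow? Q? = map′ (λ (i , j , k , q) → (i , j , k) , q) (λ ((i , j , k) , q) → i , j , k , q)
                   (any? λ i → any? λ j → any? λ k → Q? (i , j , k))

successor : ∀ {Q : Flow N K → Set} → Bool → Dec (∃ Q) → Maybe (Flow N K × Bool)
successor σ (yes (x , _)) = just (x , σ)
successor σ (no _)        = nothing

successor-just : ∀ {Q : Flow N K → Set} {σ x τ} (d : Dec (∃ Q)) → successor σ d ≡ just (x , τ) → Q x × τ ≡ σ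
successor-just (yes (_ , q)) refl = q , refl

successor-occupied : ∀ {Q : Flow N K → Set} {σ y} (d : Dec (∃ Q)) → Q y →
                     ∃[ x ] (successor σ d ≡ just (x , σ) × Q x)
successor-occupied (yes (x , q)) _ = x , refl , q
successor-occupied (no none)     q = contradiction (_ , q) none

bump : (Flow N K → ℕ) → Flow N K → Flow N K → ℕ
bump n g f = if does (f ≟ᶠ g) then suc (n f) else n f

bump-≡ : ∀ n (g : Flow N K) → bump n g g ≡ suc (n g)
bump-≡ n g = if-dec-yes (g ≟ᶠ g) refl

bump-≢ : ∀ n {f g : Flow N K} → f ≢ g → bump n g f ≡ n f
bump-≢ n {f} {g} f≢g = if-dec-no (f ≟ᶠ g) f≢g

n≤bump : ∀ n (g f : Flow N K) → n f ≤ bump n g f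
n≤bump n g f with f ≟ᶠ g
... | yes refl = n≤1+n (n f)
... | no _     = ≤-refl

boolToFin : Bool → Fin 2
boolToFin true  = Fin.zero
boolToFin false = Fin.suc Fin.zero

boolToFin-injective : ∀ {b c} → boolToFin b ≡ boolToFin c → b ≡ c
boolToFin-injective {true}  {true}  _ = refl
boolToFin-injective {false} {false} _ = refl

encode : Maybe (Flow N K × Bool) → Fin (suc (N * (N * (K * 2))))
encode nothing                   = Fin.zero
encode (just ((i , j , k) , τ)) = Fin.suc (combine i (combine j (combine k (boolToFin τ))))

encode-injective : ∀ {x y : Maybe (Flow N K × Bool)} → encode x ≡ encode y → x ≡ y
encode-injective {x = nothing} {nothing} _ = refl
encode-injective {x = just ((i , j , k) , τ)} {just ((i′ , j′ , k′) , τ′)} eq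
  with refl , eq₁ ← combine-injective i _ i′ _ (Finₚ.suc-injective eq)
  with refl , eq₂ ← combine-injective j _ j′ _ eq₁
  with refl , eq₃ ← combine-injective k _ k′ _ eq₂
  with refl ← boolToFin-injective eq₃ = refl

module Transmission {m N K : ℕ} (coreOf : Flow N K → Fin m) (T : ℕ) where

  Activity : Set
  Activity = Flow N K → ℕ → Bool

  -- Feasible, for an arbitrary demand n instead of a Demand matrix.
  record Transmits (n : Flow N K → ℕ) (c : Activity) : Set where
    field
      within       : ∀ f t → c f t ≡ true → t < T
      sends        : ∀ f → countActive (c f) T ≡ n f
      conflictFree : ∀ f g t → f ≢ g → coreOf f ≡ coreOf g → c f t ≡ true → c g t ≡ true → PortDisjoint f g
  open Transmits public

  Transmits-cong : ∀ {n n' c} → (∀ f → n f ≡ n' f) → Transmits n c → Transmits n' c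
  Transmits-cong n≗n' tr = record
    { within = within tr ; sends = λ f → trans (sends tr f) (n≗n' f) ; conflictFree = conflictFree tr }

  Occupies : Activity → Fin m → Side → Fin N → ℕ → Flow N K → Set
  Occupies c h s i t x = coreOf x ≡ h × port s x ≡ i × c x t ≡ true

  Idle : Activity → Fin m → Side → Fin N → ℕ → Set
  Idle c h s i t = ∀ x → ¬ Occupies c h s i t x

  occupant? : ∀ c h s i t → Dec (∃ (Occupies c h s i t))
  occupant? c h s i t = anyFlow? λ x → coreOf x ≟ h ×-dec port s x ≟ i ×-dec c x t Bool.≟ true

  sole-occupant : ∀ {n c h i t x y} → Transmits n c → ∀ s →
                  Occupies c h s i t x → Occupies c h s i t y → x ≡ y
  sole-occupant {x = x} {y} tr s (cx , px , ax) (cy , py , ay) with x ≟ᶠ y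
  ... | yes x≡y = x≡y
  ... | no  x≢y = contradiction (trans px (sym py))
                    (PortDisjoint⇒port≢ s (conflictFree tr x y _ x≢y (trans cx (sym cy)) ax ay))

  addUnit : Activity → Flow N K → ℕ → Activity
  addUnit c g a f = if does (f ≟ᶠ g) then update (c g) a true else c f

  transmits-addUnit : ∀ {n c g a} → Transmits n c → a < T →
                      (∀ s → Idle c (coreOf g) s (port s g) a) → Transmits (bump n g) (addUnit c g a)
  transmits-addUnit {n} {c} {g} {a} tr a<T idle = record
    { within = within′ ; sends = sends′ ; conflictFree = conflictFree′ }
    where
    new-or-old : ∀ f t → addUnit c g a f t ≡ true → (f ≡ g × t ≡ a) ⊎ c f t ≡ true
    new-or-old f t active with f ≟ᶠ g | t ≟ℕ a
    ... | yes refl | yes refl = inj₁ (refl , refl)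
    ... | yes refl | no t≢a   = inj₂ (trans (sym (update-≢ (c g) true t≢a)) active)
    ... | no _     | _        = inj₂ active
    within′ : ∀ f t → addUnit c g a f t ≡ true → t < T
    within′ f t active with new-or-old f t active
    ... | inj₁ (_ , refl) = a<T
    ... | inj₂ old        = within tr f t old
    sends′ : ∀ f → countActive (addUnit c g a f) T ≡ bump n g f
    sends′ f with f ≟ᶠ g
    ... | no _     = sends tr f
    ... | yes refl = +-cancelʳ-≡ (bit (c g a)) _ _ (begin
      countActive (update (c g) a true) T + bit (c g a) ≡⟨ countActive-update (c g) true T a<T ⟩
      countActive (c g) T + 1                           ≡⟨ cong (_+ 1) (sends tr g) ⟩
      n g + 1                                           ≡⟨ trans (+-comm (n g) 1) (sym (+-identityʳ _)) ⟩
      suc (n g) + 0                                     ≡⟨ cong (λ b → suc (n g) + bit b) (sym wasIdle) ⟩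
      suc (n g) + bit (c g a)                           ∎)
      where
      open ≡-Reasoning
      wasIdle : c g a ≡ false
      wasIdle = ¬-not λ active → idle input g (refl , refl , active)
    disjoint-from-g : ∀ f → coreOf f ≡ coreOf g → c f a ≡ true → PortDisjoint g f
    disjoint-from-g f same active = portDisjoint λ s eq → idle s f (same , sym eq , active)
    conflictFree′ : ∀ f f′ t → f ≢ f′ → coreOf f ≡ coreOf f′ →
                    addUnit c g a f t ≡ true → addUnit c g a f′ t ≡ true → PortDisjoint f f′
    conflictFree′ f f′ t f≢f′ same active active′ with new-or-old f t active | new-or-old f′ t active′
    ... | inj₂ old       | inj₂ old′       = conflictFree tr f f′ t f≢f′ same old old′
    ... | inj₁ (refl , refl) | inj₂ old′    = disjoint-from-g f′ (sym same) old′
    ... | inj₂ old       | inj₁ (refl , refl) = PortDisjoint-sym f′ f (disjoint-from-g f same old)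
    ... | inj₁ (refl , _) | inj₁ (refl , _) = contradiction refl f≢f′

  -- The Kempe chain of slots a and b on core h that starts at the flow g₁
  -- using output port j in slot a.  A state (e , τ) says that e is active
  -- in slot τ (true for a, false for b); the next flow shares port
  -- (side τ) with e and is active in the other slot.
  module KempeChain {n c} (tr : Transmits n c) (h : Fin m) (i j : Fin N) (a b : ℕ) (a<T : a < T) (b<T : b < T)
                    (idleᵢ : Idle c h input i a) (idleⱼ : Idle c h output j b)
                    (g₁ : Flow N K) (occ₁ : Occupies c h output j a g₁) where

    slot : Bool → ℕ
    slot true  = a
    slot false = b

    side : Bool → Side
    side true  = input
    side false = output

    advance : Maybe (Flow N K × Bool) → Maybe (Flow N K × Bool)
    advance nothing        = nothing
    advance (just (e , τ)) = successor (not τ) (occupant? c h (side τ) (port (side τ) e) (slot (not τ)))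

    walk : ℕ → Maybe (Flow N K × Bool)
    walk = fold (just (g₁ , true)) advance

    advance-just : ∀ mw {x σ} → advance mw ≡ just (x , σ) →
                   ∃[ e ] ∃[ τ ] (mw ≡ just (e , τ) × σ ≡ not τ ×
                                  Occupies c h (side τ) (port (side τ) e) (slot (not τ)) x)
    advance-just (just (e , τ)) next =
      let (occ , σ≡) = successor-just (occupant? c h (side τ) (port (side τ) e) (slot (not τ))) next
      in e , τ , refl , σ≡ , occ

    walk-active : ∀ k {y τ} → walk k ≡ just (y , τ) → coreOf y ≡ h × c y (slot τ) ≡ true
    walk-active zero    refl = proj₁ occ₁ , proj₂ (proj₂ occ₁)
    walk-active (suc k) wk with advance-just (walk k) wk
    ... | _ , _ , _ , refl , (cy , _ , ay) = cy , ay

    L : ℕ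
    L = suc (N * (N * (K * 2)))

    InChain : Flow N K → Set
    InChain e = ∃[ k ] (k < L × ∃[ τ ] walk k ≡ just (e , τ))

    visits? : ∀ e (mw : Maybe (Flow N K × Bool)) → Dec (∃[ τ ] mw ≡ just (e , τ))
    visits? e nothing = no λ { (_ , ()) }
    visits? e (just (x , τ)) with x ≟ᶠ e
    ... | yes refl = yes (τ , refl)
    ... | no x≢e   = no λ (_ , eq) → x≢e (cong proj₁ (just-injective eq))

    inChain? : ∀ e → Dec (InChain e)
    inChain? e = anyUpTo? (λ k → visits? e (walk k)) L

    chain-core : ∀ {y} → InChain y → coreOf y ≡ h
    chain-core (k , _ , _ , wk) = proj₁ (walk-active k wk)

    g₁∈chain : InChain g₁
    g₁∈chain = 0 , s≤s z≤n , true , refl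

    -- At step L the walk is back at an earlier state (pigeonhole), so
    -- bounding the chain by L loses no successor.
    walk-extends : ∀ {k e τ x σ} → k < L → walk k ≡ just (e , τ) →
                   advance (just (e , τ)) ≡ just (x , σ) → InChain x
    walk-extends {k} {σ = σ} k<L wk next with m≤n⇒m<n∨m≡n k<L
    ... | inj₁ 1+k<L = suc k , 1+k<L , σ , trans (cong advance wk) next
    ... | inj₂ refl  =
      let (k′ , k′<L , revisit) = fold-recurs (encode {N = N} {K = K}) encode-injective (just (g₁ , true)) advance
      in k′ , k′<L , σ , trans (sym revisit) (trans (cong advance wk) next)

    same-slot : ∀ {x y k σ} s → k < L → walk k ≡ just (y , σ) →
                coreOf x ≡ h → port s x ≡ port s y → c x (slot σ) ≡ true → InChain x
    same-slot {k = k} s k<L wk cx px ax =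
      let (cy , ay) = walk-active k wk
      in subst InChain (sole-occupant tr s (cy , refl , ay) (cx , px , ax)) (k , k<L , _ , wk)

    forward : ∀ {x y k} τ → k < L → walk k ≡ just (y , τ) →
              coreOf x ≡ h → port (side τ) x ≡ port (side τ) y → c x (slot (not τ)) ≡ true → InChain x
    forward {y = y} τ k<L wk cx px ax
      with x′ , next , occ′ ← successor-occupied (occupant? c h (side τ) (port (side τ) y) (slot (not τ))) (cx , px , ax)
      = subst InChain (sole-occupant tr (side τ) occ′ (cx , px , ax)) (walk-extends k<L wk next)

    backward : ∀ {x y k} τ → k < L → walk k ≡ just (y , τ) →
               coreOf x ≡ h → port (side (not τ)) x ≡ port (side (not τ)) y → c x (slot (not τ)) ≡ true → InChain x
    backward {x} {k = zero} true _ refl cx px ax = ⊥-elim (idleⱼ x (cx , trans px (proj₁ (proj₂ occ₁)) , ax))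
    backward {x} {k = suc k} τ k<L wk cx px ax with advance-just (walk k) wk
    ... | _ , true  , wz , refl , (_ , py , _) = same-slot input  (<-trans (n<1+n k) k<L) wz cx (trans px py) ax
    ... | _ , false , wz , refl , (_ , py , _) = same-slot output (<-trans (n<1+n k) k<L) wz cx (trans px py) ax

    chain-closed : ∀ {x y} τ s → InChain y → c y (slot τ) ≡ true →
                   coreOf x ≡ h → port s x ≡ port s y → c x (slot (not τ)) ≡ true → InChain x
    chain-closed true  input  (k , k<L , true  , wk) _ = forward true k<L wk
    chain-closed true  output (k , k<L , true  , wk) _ = backward true k<L wk
    chain-closed false output (k , k<L , false , wk) _ = forward false k<L wk
    chain-closed false input  (k , k<L , false , wk) _ = backward false k<L wk
    chain-closed true  s      (k , k<L , false , wk) _ = same-slot s k<L wk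
    chain-closed false s      (k , k<L , true  , wk) _ = same-slot s k<L wk

    chain-avoids-input : ∀ {y} → InChain y → coreOf y ≡ h → src y ≡ i → c y b ≡ true → ⊥
    chain-avoids-input {y} (k , _ , true , wk) cy sy _ = idleᵢ y (cy , sy , proj₂ (walk-active k wk))
    chain-avoids-input (suc k , _ , false , wk) cy sy _ with advance-just (walk k) wk
    ... | z , true , wz , _ , (_ , sz , _) =
      let (cz , az) = walk-active k wz in idleᵢ z (cz , trans (sym sz) sy , az)

    swapped : Activity
    swapped e = if does (inChain? e) then swapSlots a b (c e) else c e

    swapSlots-slot : ∀ u τ → swapSlots a b u (slot τ) ≡ u (slot (not τ))
    swapSlots-slot u true  = swapSlots-at₁ a b u
    swapSlots-slot u false = swapSlots-at₂ a b u

    swapped-at : ∀ e τ → swapped e (slot τ) ≡ true →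
                 (InChain e × c e (slot (not τ)) ≡ true) ⊎ (¬ InChain e × c e (slot τ) ≡ true)
    swapped-at e τ = by (inChain? e)
      where
      by : (d : Dec (InChain e)) → (if does d then swapSlots a b (c e) else c e) (slot τ) ≡ true →
           (InChain e × c e (slot (not τ)) ≡ true) ⊎ (¬ InChain e × c e (slot τ) ≡ true)
      by (yes inE) active = inj₁ (inE , trans (sym (swapSlots-slot (c e) τ)) active)
      by (no ¬inE) active = inj₂ (¬inE , active)

    swapped-elsewhere : ∀ e {t} → t ≢ a → t ≢ b → swapped e t ≡ c e t
    swapped-elsewhere e {t} t≢a t≢b = by (inChain? e)
      where
      by : (d : Dec (InChain e)) → (if does d then swapSlots a b (c e) else c e) t ≡ c e t
      by (yes _) = swapSlots-elsewhere a b (c e) t≢a t≢b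
      by (no _)  = refl

    -- Only a pair of one swapped and one unswapped flow could newly
    -- clash, and closure of the chain rules that out.
    separated : ∀ {x y} τ → InChain y → c y (slot (not τ)) ≡ true → ¬ InChain x → c x (slot τ) ≡ true →
                coreOf x ≡ coreOf y → PortDisjoint x y
    separated {x} τ inY ay ¬inX ax same = portDisjoint λ s eq →
      ¬inX (chain-closed (not τ) s inY ay (trans same (chain-core inY)) eq
                         (subst (λ σ → c x (slot σ) ≡ true) (sym (not-involutive τ)) ax))

    conflictFree-at : ∀ τ f g → f ≢ g → coreOf f ≡ coreOf g →
                      swapped f (slot τ) ≡ true → swapped g (slot τ) ≡ true → PortDisjoint f g
    conflictFree-at τ f g f≢g same af ag with swapped-at f τ af | swapped-at g τ ag
    ... | inj₁ (_ , af′)    | inj₁ (_ , ag′)    = conflictFree tr f g (slot (not τ)) f≢g same af′ ag′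
    ... | inj₂ (_ , af′)    | inj₂ (_ , ag′)    = conflictFree tr f g (slot τ) f≢g same af′ ag′
    ... | inj₁ (inF , af′)  | inj₂ (¬inG , ag′) = PortDisjoint-sym g f (separated τ inF af′ ¬inG ag′ (sym same))
    ... | inj₂ (¬inF , af′) | inj₁ (inG , ag′)  = separated τ inG ag′ ¬inF af′ same

    transmits-swapped : Transmits n swapped
    transmits-swapped = record { within = within′ ; sends = sends′ ; conflictFree = conflictFree′ }
      where
      within′ : ∀ f t → swapped f t ≡ true → t < T
      within′ f t active with t ≟ℕ a | t ≟ℕ b
      ... | yes refl | _        = a<T
      ... | no _     | yes refl = b<T
      ... | no t≢a   | no t≢b   = within tr f t (trans (sym (swapped-elsewhere f t≢a t≢b)) active)
      sends′ : ∀ f → countActive (swapped f) T ≡ n f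
      sends′ f = trans (by (inChain? f)) (sends tr f)
        where
        by : (d : Dec (InChain f)) → countActive (if does d then swapSlots a b (c f) else c f) T ≡ countActive (c f) T
        by (yes _) = countActive-swapSlots (c f) T a<T b<T
        by (no _)  = refl
      conflictFree′ : ∀ f g t → f ≢ g → coreOf f ≡ coreOf g →
                      swapped f t ≡ true → swapped g t ≡ true → PortDisjoint f g
      conflictFree′ f g t f≢g same af ag with t ≟ℕ a | t ≟ℕ b
      ... | yes refl | _        = conflictFree-at true f g f≢g same af ag
      ... | no _     | yes refl = conflictFree-at false f g f≢g same af ag
      ... | no t≢a   | no t≢b   = conflictFree tr f g t f≢g same
                                    (trans (sym (swapped-elsewhere f t≢a t≢b)) af)
                                    (trans (sym (swapped-elsewhere g t≢a t≢b)) ag)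

    idleᵢ-swapped : Idle swapped h input i a
    idleᵢ-swapped x (cx , sx , ax) with swapped-at x true ax
    ... | inj₁ (inX , bx)  = chain-avoids-input inX cx sx bx
    ... | inj₂ (_ , ax′)   = idleᵢ x (cx , sx , ax′)

    idleⱼ-swapped : Idle swapped h output j a
    idleⱼ-swapped x (cx , dx , ax) with swapped-at x true ax
    ... | inj₁ (_ , bx)     = idleⱼ x (cx , dx , bx)
    ... | inj₂ (¬inX , ax′) = ¬inX (subst InChain (sole-occupant tr output occ₁ (cx , dx , ax′)) g₁∈chain)

  kempe-swap : ∀ {n c h i j a b} → Transmits n c → a < T → b < T → Idle c h input i a → Idle c h output j b →
               ∃[ c′ ] (Transmits n c′ × Idle c′ h input i a × Idle c′ h output j a)
  kempe-swap {c = c} {h} {j = j} {a} tr a<T b<T idleᵢ idleⱼ with occupant? c h output j a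
  ... | no  free        = c , tr , idleᵢ , λ x occ → free (x , occ)
  ... | yes (g₁ , occ₁) = swapped , transmits-swapped , idleᵢ-swapped , idleⱼ-swapped
    where open KempeChain tr _ _ _ _ _ a<T b<T idleᵢ idleⱼ g₁ occ₁

  add-unit : ∀ {n c g a b} → Transmits n c → a < T → b < T →
             Idle c (coreOf g) input (src g) a → Idle c (coreOf g) output (dst g) b → ∃[ c′ ] Transmits (bump n g) c′
  add-unit tr a<T b<T idleᵢ idleⱼ with kempe-swap tr a<T b<T idleᵢ idleⱼ
  ... | c′ , tr′ , idleᵢ′ , idleⱼ′ = _ , transmits-addUnit tr′ a<T λ where
    input  → idleᵢ′
    output → idleⱼ′

countActive-never : ∀ T → countActive (λ _ → false) T ≡ 0
countActive-never zero    = refl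
countActive-never (suc T) = trans (+-identityʳ _) (countActive-never T)

copies : List (Flow N K) → Flow N K → ℕ
copies []       = λ _ → 0
copies (g ∷ us) = bump (copies us) g

copies-++ : ∀ (us vs : List (Flow N K)) f → copies (us ++ vs) f ≡ copies us f + copies vs f
copies-++ []       vs f = refl
copies-++ (g ∷ us) vs f with f ≟ᶠ g
... | yes refl = cong suc (copies-++ us vs f)
... | no _     = copies-++ us vs f

copies-replicate-≡ : ∀ k (f : Flow N K) → copies (replicate k f) f ≡ k
copies-replicate-≡ zero    f = refl
copies-replicate-≡ (suc k) f = trans (bump-≡ (copies (replicate k f)) f) (cong suc (copies-replicate-≡ k f))

copies-replicate-≢ : ∀ k {f g : Flow N K} → f ≢ g → copies (replicate k g) f ≡ 0
copies-replicate-≢ zero    f≢g = refl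
copies-replicate-≢ (suc k) f≢g = trans (bump-≢ (copies (replicate k _)) f≢g) (copies-replicate-≢ k f≢g)

units : Demand N K → List (Flow N K) → List (Flow N K)
units D []       = []
units D (g ∷ fs) = replicate (size D g) g ++ units D fs

copies-units-∉ : ∀ D (fs : List (Flow N K)) {f} → f ∉ fs → copies (units D fs) f ≡ 0
copies-units-∉ D []       f∉ = refl
copies-units-∉ D (g ∷ fs) {f} f∉ = begin
  copies (replicate (size D g) g ++ units D fs) f          ≡⟨ copies-++ (replicate (size D g) g) _ f ⟩
  copies (replicate (size D g) g) f + copies (units D fs) f ≡⟨ cong₂ _+_ (copies-replicate-≢ (size D g) (f∉ ∘ here))
                                                                        (copies-units-∉ D fs (f∉ ∘ there)) ⟩
  0                                                         ∎
  where open ≡-Reasoning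

copies-units-∈ : ∀ D {fs : List (Flow N K)} {f} → Unique fs → f ∈ fs → copies (units D fs) f ≡ size D f
copies-units-∈ D {g ∷ fs} {f} (g∉fs ∷ u) f∈ = trans (copies-++ (replicate (size D g) g) _ f) (by f∈)
  where
  by : f ∈ g ∷ fs → copies (replicate (size D g) g) f + copies (units D fs) f ≡ size D f
  by (here refl) = trans (cong₂ _+_ (copies-replicate-≡ (size D f) f) (copies-units-∉ D fs (All¬⇒¬Any g∉fs)))
                         (+-identityʳ _)
  by (there f∈fs) = cong₂ _+_ (copies-replicate-≢ (size D g) λ { refl → All.lookup g∉fs f∈fs refl })
                              (copies-units-∈ D u f∈fs)

-- König's edge-colouring theorem, applied on every core.
module Construction {m N K : ℕ} (D : Demand N K) (as : List (Flow N K × Fin m)) (coreOf : Flow N K → Fin m) (T : ℕ)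
  (covers : ∀ f → 0 < size D f → (f , coreOf f) ∈ as)
  (unique : Unique (map proj₁ as))
  (fits : ∀ s i h → load D s as i h ≤ T) where

  open Transmission coreOf T

  idle-port : ∀ {n c} → Transmits n c → (∀ f → n f ≤ size D f) → ∀ {g} → n g < size D g → ∀ s →
              ∃[ t ] (t < T × Idle c (coreOf g) s (port s g) t)
  idle-port {n} {c} tr n≤size {g} n<size s with idle-slot (c ∘ proj₁) sharing T busy<T
    where
    sharing : List (Flow N K × Fin m)
    sharing = assignedAt s (port s g) (coreOf g) as
    busy<T : sumBy (λ e → countActive (c (proj₁ e)) T) sharing < T
    busy<T = begin-strict
      sumBy (λ e → countActive (c (proj₁ e)) T) sharing ≡⟨ sumBy-cong sharing (λ _ → sends tr _) ⟩
      sumBy (n ∘ proj₁) sharing                          <⟨ sumBy-mono-< sharing (λ _ → n≤size _)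
                                                              (∈-filter⁺ _ (covers g (≤-trans (s≤s z≤n) n<size)) (refl , refl))
                                                              n<size ⟩
      sumBy (size D ∘ proj₁) sharing                     ≡⟨ sym (load≡sumBy D s as (port s g) (coreOf g)) ⟩
      load D s as (port s g) (coreOf g)                    ≤⟨ fits s (port s g) (coreOf g) ⟩
      T                                                  ∎
      where open ≤-Reasoning
  ... | t , t<T , silent = t , t<T , λ x (cx , px , ax) →
    let demanded = ≤-trans (≤-trans (active⇒countActive>0 T ax (within tr x t ax)) (≤-reflexive (sends tr x))) (n≤size x)
    in contradiction (trans (sym ax) (silent (∈-filter⁺ _ (covers x demanded) (px , cx)))) λ ()

  transmits-copies : ∀ us → (∀ f → copies us f ≤ size D f) → ∃[ c ] Transmits (copies us) c
  transmits-copies [] _ = (λ _ _ → false) , record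
    { within = λ _ _ () ; sends = λ _ → countActive-never T ; conflictFree = λ _ _ _ _ _ () }
  transmits-copies (g ∷ us) copies≤size =
    let (c , tr) = transmits-copies us prev≤
        fewer = ≤-trans (≤-reflexive (sym (bump-≡ (copies us) g))) (copies≤size g)
        (a , a<T , idleᵢ) = idle-port tr prev≤ fewer input
        (b , b<T , idleⱼ) = idle-port tr prev≤ fewer output
    in add-unit tr a<T b<T idleᵢ idleⱼ
    where
    prev≤ : ∀ f → copies us f ≤ size D f
    prev≤ f = ≤-trans (n≤bump (copies us) g f) (copies≤size f)

  transmits-all : ∃[ c ] Transmits (size D) c
  transmits-all =
    let (c , tr) = transmits-copies (units D (map proj₁ as)) (≤-reflexive ∘ exact) in c , Transmits-cong exact tr
    where
    open import Data.List.Membership.DecPropositional (_≟ᶠ_ {N} {K}) using (_∈?_)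
    exact : ∀ f → copies (units D (map proj₁ as)) f ≡ size D f
    exact f with f ∈? map proj₁ as
    ... | yes f∈ = copies-units-∈ D unique f∈
    ... | no  f∉ = trans (copies-units-∉ D _ f∉)
                         (sym (n≤0⇒n≡0 (≮⇒≥ λ pos → f∉ (∈-map⁺ proj₁ (covers f pos)))))

-- Lower bounds from a feasible schedule

module LowerBounds {m N K : ℕ} (D : Demand N K) (S : Schedule m N K) (T* : ℕ) (feasible : Feasible D S T*) where

  private
    sends* : ∀ f → countActive (active S f) T* ≡ size D f
    sends* = proj₁ (proj₂ feasible)

    never-together : ∀ s {i f g} fs → f ∈ atPort s i fs → g ∈ atPort s i fs → f ≢ g → core S f ≡ core S g →
                     ∀ t → active S f t ≡ true → active S g t ≡ true → ⊥
    never-together s fs f∈ g∈ f≢g same t af ag =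
      PortDisjoint⇒port≢ s (proj₂ (proj₂ feasible) _ _ t f≢g same af ag)
        (trans (∈atPort⇒port s fs f∈) (sym (∈atPort⇒port s fs g∈)))

  size≤T* : ∀ f → size D f ≤ T*
  size≤T* f = subst (_≤ T*) (sends* f) (countActive≤ (active S f) T*)

  portLoad≤m*T* : ∀ s i fs → Unique fs → sumBy (size D) (atPort s i fs) ≤ m * T*
  portLoad≤m*T* s i fs u = subst (_≤ m * T*) (sumBy-cong (atPort s i fs) (λ _ → sends* _)) (upTo T*)
    where
    flows : List (Flow N K)
    flows = atPort s i fs
    perSlot : ∀ t → sumBy (λ f → bit (active S f t)) flows ≤ m
    perSlot t = sumBy-bit≤m (core S) (λ f → active S f t) flows (filter⁺ _ u) λ {f} {g} f∈ g∈ af ag same →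
      decidable-stable (f ≟ᶠ g) λ f≢g → never-together s fs f∈ g∈ f≢g same t af ag
    upTo : ∀ T → sumBy (λ f → countActive (active S f) T) flows ≤ m * T
    upTo zero    = ≤-reflexive (trans (sumBy-zero flows) (sym (*-zeroʳ m)))
    upTo (suc T) = begin
      sumBy (λ f → countActive (active S f) T + bit (active S f T)) flows
        ≡⟨ sumBy-+ (λ f → countActive (active S f) T) (λ f → bit (active S f T)) flows ⟩
      sumBy (λ f → countActive (active S f) T) flows + sumBy (λ f → bit (active S f T)) flows
        ≤⟨ +-mono-≤ (upTo T) (perSlot T) ⟩
      m * T + m
        ≡⟨ trans (+-comm (m * T) m) (sym (*-suc m T)) ⟩
      m * suc T ∎
      where open ≤-Reasoning

  Big : Flow N K → Set
  Big f = T* < size D f + size D f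

  -- Two big flows sharing a port cannot share a core.
  bigFlows≤m : ∀ s i fs → Unique fs → (∀ {f} → f ∈ atPort s i fs → Big f) → length (atPort s i fs) ≤ m
  bigFlows≤m s i fs u big = subst (_≤ m) (sumBy-one flows)
    (sumBy-bit≤m (core S) (λ _ → true) flows (filter⁺ _ u) λ {f} {g} f∈ g∈ _ _ same →
      decidable-stable (f ≟ᶠ g) λ f≢g → let apart = disjoint f∈ g∈ f≢g same in
        <-irrefl refl (begin-strict
          T* + T*                                       <⟨ +-mono-< (big f∈) (big g∈) ⟩
          (size D f + size D f) + (size D g + size D g) ≡⟨ interchange (size D f) _ _ _ ⟩
          (size D f + size D g) + (size D f + size D g) ≤⟨ +-mono-≤ apart apart ⟩
          T* + T*                                       ∎))
    where
    open ≤-Reasoning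
    flows : List (Flow N K)
    flows = atPort s i fs
    disjoint : ∀ {f g} → f ∈ flows → g ∈ flows → f ≢ g → core S f ≡ core S g → size D f + size D g ≤ T*
    disjoint {f} {g} f∈ g∈ f≢g same = subst₂ (λ x y → x + y ≤ T*) (sends* f) (sends* g)
      (disjoint⇒countActive-+≤ T* (never-together s fs f∈ g∈ f≢g same))

-- The FLPT invariant

8m∸2≡6+8m′ : ∀ m′ → 8 * suc m′ ∸ 2 ≡ 6 + 8 * m′
8m∸2≡6+8m′ m′ = cong (_∸ 2) (*-suc 8 m′)

-- With 3d ≤ 2T*, the excess 3(m−1)d is absorbed by 2(m−1)T*.
small-case : ∀ m′ d μ T* → suc m′ * μ + (d + d) ≤ suc m′ * T* + suc m′ * T* → 3 * d ≤ 2 * T* →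
             3 * suc m′ * (d + μ) ≤ (8 * suc m′ ∸ 2) * T*
small-case m′ d μ T* total small rewrite 8m∸2≡6+8m′ m′ = begin
  3 * suc m′ * (d + μ)                             ≤⟨ m≤m+n _ (3 * d) ⟩
  3 * suc m′ * (d + μ) + 3 * d                     ≡⟨ expand m′ d μ ⟩
  3 * (suc m′ * μ + (d + d)) + m′ * (3 * d)        ≤⟨ +-mono-≤ (*-monoʳ-≤ 3 total) (*-monoʳ-≤ m′ small) ⟩
  3 * (suc m′ * T* + suc m′ * T*) + m′ * (2 * T*)  ≡⟨ collect m′ T* ⟩
  (6 + 8 * m′) * T*                                ∎
  where
  open ≤-Reasoning
  expand : ∀ m′ d μ → 3 * suc m′ * (d + μ) + 3 * d ≡ 3 * (suc m′ * μ + (d + d)) + m′ * (3 * d)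
  expand = solve-∀
  collect : ∀ m′ T → 3 * (suc m′ * T + suc m′ * T) + m′ * (2 * T) ≡ (6 + 8 * m′) * T
  collect = solve-∀

large-case : ∀ m′ d μ T* → d ≤ T* → μ ≤ T* → 3 * suc m′ * (d + μ) ≤ (8 * suc m′ ∸ 2) * T*
large-case m′ d μ T* d≤T* μ≤T* rewrite 8m∸2≡6+8m′ m′ = begin
  3 * suc m′ * (d + μ)    ≤⟨ *-monoʳ-≤ (3 * suc m′) (+-mono-≤ d≤T* μ≤T*) ⟩
  3 * suc m′ * (T* + T*)  ≡⟨ double m′ T* ⟩
  (6 + 6 * m′) * T*       ≤⟨ *-monoˡ-≤ T* (+-monoʳ-≤ 6 (*-monoˡ-≤ m′ (m≤m+n 6 2))) ⟩
  (6 + 8 * m′) * T*       ∎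
  where
  open ≤-Reasoning
  double : ∀ m′ T → 3 * suc m′ * (T + T) ≡ (6 + 6 * m′) * T
  double = solve-∀

big-threshold : ∀ {d x T*} → 2 * T* < 3 * d → d ≤ x → T* < x + x
big-threshold {d} {x} {T*} 2T*<3d d≤x = ≰⇒> λ x+x≤T* → <⇒≱ 2T*<3d (begin
  3 * d        ≤⟨ *-monoʳ-≤ 3 d≤x ⟩
  3 * x        ≤⟨ m≤m+n (3 * x) x ⟩
  3 * x + x    ≡⟨ four x ⟩
  2 * (x + x)  ≤⟨ *-monoʳ-≤ 2 x+x≤T* ⟩
  2 * T*       ∎)
  where
  open ≤-Reasoning
  four : ∀ x → 3 * x + x ≡ 2 * (x + x)
  four = solve-∀

module FLPTAnalysis {m′ N K : ℕ} (D : Demand N K) (S : Schedule (suc m′) N K) (T* : ℕ) (feasible : Feasible D S T*) where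

  open LowerBounds D S T* feasible

  Assignment : Set
  Assignment = List (Flow N K × Fin (suc m′))

  Bounded : Assignment → Set
  Bounded as = ∀ s i h → 3 * suc m′ * load D s as i h ≤ (8 * suc m′ ∸ 2) * T*

  bounded-[] : Bounded []
  bounded-[] input  _ _ = ≤-trans (≤-reflexive (*-zeroʳ (3 * suc m′))) z≤n
  bounded-[] output _ _ = ≤-trans (≤-reflexive (*-zeroʳ (3 * suc m′))) z≤n

  -- the quantity FLPT minimises over the cores
  coreLoad : Assignment → Flow N K → Fin (suc m′) → ℕ
  coreLoad acc f h = load D input acc (src f) h + load D output acc (dst f) h

  sumBy-coreLoad : ∀ acc f → sumBy (coreLoad acc f) (allFin (suc m′)) ≡
                   sumBy (size D) (atPort input (src f) (map proj₁ acc)) + sumBy (size D) (atPort output (dst f) (map proj₁ acc))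
  sumBy-coreLoad acc f = trans (sumBy-+ (load D input acc (src f)) (load D output acc (dst f)) (allFin (suc m′)))
                               (cong₂ _+_ (sumBy-load-cores D input (src f) acc) (sumBy-load-cores D output (dst f) acc))

  portLoad-with : ∀ s f (acc : Assignment) → Unique (f ∷ map proj₁ acc) →
                  size D f + sumBy (size D) (atPort s (port s f) (map proj₁ acc)) ≤ suc m′ * T*
  portLoad-with s f acc u =
    subst (_≤ suc m′ * T*) (cong (sumBy (size D)) (atPort-own s f (map proj₁ acc)))
          (portLoad≤m*T* s (port s f) (f ∷ map proj₁ acc) u)

  load≤count*T* : ∀ s (acc : Assignment) i h → load D s acc i h ≤ length (assignedAt s i h acc) * T*
  load≤count*T* s acc i h =
    subst (_≤ length (assignedAt s i h acc) * T*) (sym (load≡sumBy D s acc i h))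
          (sumBy≤length* (assignedAt s i h acc) λ _ → size≤T* _)

  coreCount : Assignment → Flow N K → Fin (suc m′) → ℕ
  coreCount acc f h = length (assignedAt input (src f) h acc) + length (assignedAt output (dst f) h acc)

  sumBy-coreCount : ∀ acc f → sumBy (coreCount acc f) (allFin (suc m′)) ≡
                    length (atPort input (src f) (map proj₁ acc)) + length (atPort output (dst f) (map proj₁ acc))
  sumBy-coreCount acc f =
    trans (sumBy-+ (λ h → length (assignedAt input (src f) h acc)) _ (allFin (suc m′)))
          (cong₂ _+_ (sumBy-length-cores input (src f) acc) (sumBy-length-cores output (dst f) acc))

  -- Each of the two ports of f already carries at most m − 1 of the big
  -- processed flows, so some core carries at most one of them.
  sparse-core : ∀ {acc f} → Unique (f ∷ map proj₁ acc) → (∀ {x} → x ∈ f ∷ map proj₁ acc → Big x) →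
                ∃[ h ] coreCount acc f h ≤ 1
  sparse-core {acc} {f} u big with any? (λ h → coreCount acc f h ≤? 1)
  ... | yes sparse = sparse
  ... | no  dense  = contradiction (begin
    suc m′ * 2                                  ≤⟨ m*≤sumBy-allFin (λ h → ≰⇒> λ le → dense (h , le)) ⟩
    sumBy (coreCount acc f) (allFin (suc m′))   ≡⟨ sumBy-coreCount acc f ⟩
    length (atPort input (src f) (map proj₁ acc)) + length (atPort output (dst f) (map proj₁ acc))
                                                ≤⟨ +-mono-≤ (crowded input) (crowded output) ⟩
    m′ + m′                                     ∎) (<⇒≱ m′+m′<m*2)
    where
    open ≤-Reasoning
    crowded : ∀ s → length (atPort s (port s f) (map proj₁ acc)) ≤ m′
    crowded s = ≤-pred (subst (λ xs → length xs ≤ suc m′) (atPort-own s f (map proj₁ acc))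
                          (bigFlows≤m s (port s f) (f ∷ map proj₁ acc) u λ x∈ → big (∈atPort⇒∈ s _ x∈)))
    m′+m′<m*2 : m′ + m′ < suc m′ * 2
    m′+m′<m*2 = <-≤-trans (n<1+n _) (≤-trans (n≤1+n _) (≤-reflexive (sym (double m′))))
      where
      double : ∀ m′ → suc m′ * 2 ≡ 2 + (m′ + m′)
      double = solve-∀

  averaged-load : ∀ {acc f h*} → Unique (f ∷ map proj₁ acc) → (∀ h → coreLoad acc f h* ≤ coreLoad acc f h) →
                  suc m′ * coreLoad acc f h* + (size D f + size D f) ≤ suc m′ * T* + suc m′ * T*
  averaged-load {acc} {f} {h*} u minimal = begin
    suc m′ * coreLoad acc f h* + (d + d)                ≤⟨ +-monoˡ-≤ (d + d) (m*≤sumBy-allFin minimal) ⟩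
    sumBy (coreLoad acc f) (allFin (suc m′)) + (d + d)  ≡⟨ cong (_+ (d + d)) (sumBy-coreLoad acc f) ⟩
    (Lᵢ + Lⱼ) + (d + d)                                 ≡⟨ regroup Lᵢ Lⱼ d ⟩
    (d + Lᵢ) + (d + Lⱼ)
      ≤⟨ +-mono-≤ (portLoad-with input f acc u) (portLoad-with output f acc u) ⟩
    suc m′ * T* + suc m′ * T*                           ∎
    where
    open ≤-Reasoning
    d Lᵢ Lⱼ : ℕ
    d  = size D f
    Lᵢ = sumBy (size D) (atPort input (src f) (map proj₁ acc))
    Lⱼ = sumBy (size D) (atPort output (dst f) (map proj₁ acc))
    regroup : ∀ x y d → (x + y) + (d + d) ≡ (d + x) + (d + y)
    regroup = solve-∀

  sparse-load : ∀ {acc f h*} → Unique (f ∷ map proj₁ acc) → (∀ {x} → x ∈ f ∷ map proj₁ acc → Big x) →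
                (∀ h → coreLoad acc f h* ≤ coreLoad acc f h) → coreLoad acc f h* ≤ T*
  sparse-load {acc} {f} {h*} u big minimal with h , sparse ← sparse-core u big = begin
    coreLoad acc f h*                     ≤⟨ minimal h ⟩
    coreLoad acc f h
      ≤⟨ +-mono-≤ (load≤count*T* input acc (src f) h) (load≤count*T* output acc (dst f) h) ⟩
    length (assignedAt input (src f) h acc) * T* + length (assignedAt output (dst f) h acc) * T*
                                          ≡⟨ sym (*-distribʳ-+ T* (length (assignedAt input (src f) h acc)) _) ⟩
    coreCount acc f h * T*                ≤⟨ *-monoˡ-≤ T* sparse ⟩
    1 * T*                                ≡⟨ *-identityˡ T* ⟩
    T*                                    ∎
    where open ≤-Reasoning

  placement-bound : ∀ {acc f h*} → Unique (f ∷ map proj₁ acc) → (∀ {x} → x ∈ map proj₁ acc → size D f ≤ size D x) →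
                    (∀ h → coreLoad acc f h* ≤ coreLoad acc f h) →
                    3 * suc m′ * (size D f + coreLoad acc f h*) ≤ (8 * suc m′ ∸ 2) * T*
  placement-bound {acc} {f} {h*} u heavier minimal with 3 * size D f ≤? 2 * T*
  ... | yes small = small-case m′ (size D f) (coreLoad acc f h*) T* (averaged-load u minimal) small
  ... | no  large = large-case m′ (size D f) (coreLoad acc f h*) T* (size≤T* f) (sparse-load u big minimal)
    where
    big : ∀ {x} → x ∈ f ∷ map proj₁ acc → Big x
    big (here refl) = big-threshold {size D f} (≰⇒> large) ≤-refl
    big (there x∈)  = big-threshold {size D f} (≰⇒> large) (heavier x∈)

  bounded-place : ∀ {acc f h*} → Bounded acc → 3 * suc m′ * (size D f + coreLoad acc f h*) ≤ (8 * suc m′ ∸ 2) * T* →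
                  Bounded ((f , h*) ∷ acc)
  bounded-place {acc} {f} {h*} bounded new input i h with src f ≟ i | h* ≟ h
  ... | yes refl | yes refl = ≤-trans (*-monoʳ-≤ (3 * suc m′) (+-monoʳ-≤ (size D f) (m≤m+n _ _))) new
  ... | yes _    | no _     = bounded input i h
  ... | no _     | _        = bounded input i h
  bounded-place {acc} {f} {h*} bounded new output j h with dst f ≟ j | h* ≟ h
  ... | yes refl | yes refl = ≤-trans (*-monoʳ-≤ (3 * suc m′) (+-monoʳ-≤ (size D f) (m≤n+m _ _))) new
  ... | yes _    | no _     = bounded output j h
  ... | no _     | _        = bounded output j h

  -- The pool (map proj₁ acc ʳ++ fs) of processed and pending flows does
  -- not change along a run, so the invariants are stated on it.
  flpt-bounded : ∀ {acc fs out} → FLPT D acc fs out →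
                 Unique (map proj₁ acc ʳ++ fs) → AllPairs (λ f g → size D g ≤ size D f) (map proj₁ acc ʳ++ fs) →
                 Bounded acc → Bounded out
  flpt-bounded done _ _ bounded = bounded
  flpt-bounded (step {acc} {f} h* minimal run) distinct sorted bounded =
    flpt-bounded run distinct sorted (bounded-place bounded (placement-bound new heavier minimal))
    where
    new : Unique (f ∷ map proj₁ acc)
    new with AllPairs-ʳ++⁻ (map proj₁ acc) distinct
    ... | reversed , across , _ = All.map (≢-sym ∘ All.head) across ∷ AllPairs.map ≢-sym reversed
    heavier : ∀ {x} → x ∈ map proj₁ acc → size D f ≤ size D x
    heavier x∈ = All.head (All.lookup (proj₁ (proj₂ (AllPairs-ʳ++⁻ (map proj₁ acc) sorted))) x∈)

flpt-pool : ∀ {D : Demand N K} {acc : List (Flow N K × Fin m)} {fs out} → FLPT D acc fs out →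
            map proj₁ out ʳ++ [] ≡ map proj₁ acc ʳ++ fs
flpt-pool done         = refl
flpt-pool (step _ _ run) = flpt-pool run

assignedCore : Fin m → List (Flow N K × Fin m) → Flow N K → Fin m
assignedCore h₀ []             f = h₀
assignedCore h₀ ((g , h) ∷ as) f = if does (f ≟ᶠ g) then h else assignedCore h₀ as f

assignedCore-∈ : ∀ h₀ {as : List (Flow N K × Fin m)} {f h} → Unique (map proj₁ as) → (f , h) ∈ as →
                 assignedCore h₀ as f ≡ h
assignedCore-∈ h₀ {(g , h′) ∷ as} {f} (g∉ ∷ u) f∈ with f ≟ᶠ g | f∈
... | yes refl | here refl = refl
... | yes refl | there f∈as = contradiction (∈-map⁺ proj₁ f∈as) (All¬⇒¬Any g∉)
... | no f≢g   | here refl = contradiction refl f≢g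
... | no _     | there f∈as = assignedCore-∈ h₀ u f∈as

loadTable : Demand N K → List (Flow N K × Fin m) → List ℕ
loadTable {N = N} {m = m} D as =
  cartesianProductWith (λ i h → load D input as i h ⊔ load D output as i h) (allFin N) (allFin m)

maxLoad : Demand N K → List (Flow N K × Fin m) → ℕ
maxLoad D as = max 0 (loadTable D as)

load≤maxLoad : ∀ (D : Demand N K) (as : List (Flow N K × Fin m)) s i h → load D s as i h ≤ maxLoad D as
load≤maxLoad D as s i h = ≤-trans (side≤ s) (All.lookup (xs≤max 0 (loadTable D as))
  (∈-cartesianProductWith⁺ (λ i h → load D input as i h ⊔ load D output as i h) (∈-allFin i) (∈-allFin h)))
  where
  side≤ : ∀ s → load D s as i h ≤ load D input as i h ⊔ load D output as i h
  side≤ input  = m≤m⊔n _ _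
  side≤ output = m≤n⊔m _ _

maxLoad-bounded : ∀ (D : Demand N K) (as : List (Flow N K × Fin m)) c {B} →
                  (∀ s i h → c * load D s as i h ≤ B) → c * maxLoad D as ≤ B
maxLoad-bounded {N = N} {m = m} D as c {B} bounded =
  argmax-all id {P = λ x → c * x ≤ B} (subst (_≤ B) (sym (*-zeroʳ c)) z≤n) (All.tabulate bothSides)
  where
  bothSides : ∀ {v} → v ∈ loadTable D as → c * v ≤ B
  bothSides v∈ with i , h , _ , _ , refl ← ∈-cartesianProductWith⁻ _ (allFin N) (allFin m) v∈ =
    subst (_≤ B) (sym (*-distribˡ-⊔ c _ _)) (⊔-lub (bounded input i h) (bounded output i h))

theorem2 : (m N K : ℕ) → 1 ≤ m → (D : Demand N K)
    → (order : List (Flow N K)) → FlowOrder D order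
    → (out : List (Flow N K × Fin m)) → FLPT {m} D [] order out
    → Σ[ S ∈ Schedule m N K ] Σ[ T ∈ ℕ ]
        (Feasible D S T × RespectsAssignment S out ×
         (∀ (S* : Schedule m N K) (T* : ℕ) → Feasible D S* T* →
            3 * m * T ≤ (8 * m ∸ 2) * T*))
theorem2 (suc m′) N K _ D order (distinct , positive , sorted) out run =
  record { core = coreOf ; active = proj₁ transmits-all } , maxLoad D out ,
  (within tr , sends tr , conflictFree tr) , (λ _ _ → assignedCore-∈ Fin.zero distinctOut) , optimal
  where
  pool : map proj₁ out ʳ++ [] ≡ order
  pool = flpt-pool run
  distinctOut : Unique (map proj₁ out)
  distinctOut = AllPairs.map ≢-sym (proj₁ (AllPairs-ʳ++⁻ (map proj₁ out) (subst Unique (sym pool) distinct)))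
  coreOf : Flow N K → Fin (suc m′)
  coreOf = assignedCore Fin.zero out
  covers : ∀ f → 0 < size D f → (f , coreOf f) ∈ out
  covers f pos with reverseAcc⁻ [] (map proj₁ out) (subst (f ∈_) (sym pool) (proj₂ (positive f) pos))
  ... | inj₂ f∈ with (_ , h) , fh∈ , refl ← ∈-map⁻ proj₁ f∈ =
    subst (λ h → (f , h) ∈ out) (sym (assignedCore-∈ Fin.zero distinctOut fh∈)) fh∈
  open Construction D out coreOf (maxLoad D out) covers distinctOut (load≤maxLoad D out)
  open Transmission coreOf (maxLoad D out) using (Transmits; within; sends; conflictFree)
  tr : Transmits (size D) (proj₁ transmits-all)
  tr = proj₂ transmits-all
  optimal : ∀ S* T* → Feasible D S* T* → 3 * suc m′ * maxLoad D out ≤ (8 * suc m′ ∸ 2) * T*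
  optimal S* T* feasible* = maxLoad-bounded D out (3 * suc m′)
    (flpt-bounded run distinct (Linked⇒AllPairs (λ p q → ≤-trans q p) sorted) bounded-[])
    where open FLPTAnalysis D S* T* feasible*
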